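{- Let $(S,\mathit{Tr},\mathrm{source},\mathrm{target},\ell,\smile^{\bullet})$ be a labelled transition system with concurrency, and let $B$ be a set of actions with $\mathit{Rec}\subseteq B\subseteq \mathit{Act}$. Call $t,t'\in\mathit{Tr}$ equivalent if for all $u\in\mathit{Tr}^\bullet$: $t\smile^{\bullet}u \iff t'\smile^{\bullet}u$; call an equivalence class enabled in a state $s$ if one of its elements has source $s$. Suppose that in each state only countably many equivalence classes of transitions from $\mathit{Tr}^\bullet_{\neg B}$ are enabled. Then $B$-justness is feasible: every finite path is a prefix of some $B$-just path.
   Context: A labelled transition system (LTS) is a tuple $(S,\mathit{Tr},\mathrm{source},\mathrm{target},\ell)$ with $S$ a set of states, $\mathit{Tr}$ a set of transitions, $\mathrm{source},\mathrm{target}:\mathit{Tr}\to S$ and $\ell:\mathit{Tr}\to\mathit{Lab}$, where the label set comes with subsets $\mathit{Rec}\subseteq\mathit{Act}\subseteq\mathit{Lab}$. Transitions $t$ with $\ell(t)\notin\mathit{Act}$ are indicator transitions. Let $\mathit{Tr}^\bullet=\{t\in\mathit{Tr}\mid \ell(t)\in\mathit{Act}\setminus\mathit{Rec}\}$ and $\mathit{Tr}^\bullet_{\neg B}=\{t\in\mathit{Tr}^\bullet\mid \ell(t)\notin B\}$. A path is an alternating sequence $s_0\,t_1\,s_1\,t_2\cdots$ of states and non-indicator transitions, starting with a state and either infinite or ending with a state, with $\mathrm{source}(t_i)=s_{i-1}$, $\mathrm{target}(t_i)=s_i$. An LTSC is an LTS with a relation $\smile^{\bullet}\subseteq\mathit{Tr}^\bullet\times\mathit{Tr}$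 such that (1) $t\not\smile^{\bullet}t$ for all $t\in\mathit{Tr}^\bullet$, and (2) if $t\in\mathit{Tr}^\bullet$ and $\pi$ is a path from $\mathrm{source}(t)$ to $s$ with $t\smile^{\bullet}v$ for all transitions $v$ in $\pi$, then there is $u\in\mathit{Tr}^\bullet$ with $\mathrm{source}(u)=s$, $\ell(u)=\ell(t)$ and $t\not\smile^{\bullet}u$. A path $\pi$ is $B$-just if for each suffix $\pi'$ of $\pi$ and each $t\in\mathit{Tr}^\bullet_{\neg B}$ with source the first state of $\pi'$, some transition $u$ with $t\not\smile^{\bullet}u$ occurs in $\pi'$. -}

module Defs where

open import Level using (0ℓ)
open import Data.Nat using (ℕ; zero; suc; _≤_; _<_)
open import Data.Unit using (⊤)
open import Data.Product using (Σ; _×_; _,_)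
open import Data.Maybe using (Maybe; just)
open import Relation.Nullary using (¬_)
open import Relation.Unary using (Pred; _⊆_)
open import Relation.Binary.PropositionalEquality using (_≡_)
open import Function.Bundles using (_⇔_)

record Labels : Set₁ where
  field
    Lab     : Set
    Act     : Pred Lab 0ℓ
    Rec     : Pred Lab 0ℓ
    Rec⊆Act : Rec ⊆ Act

record LTS (L : Labels) : Set₁ where
  open Labels L
  field
    S      : Set
    Tr     : Set
    source : Tr → S
    target : Tr → S
    ℓ      : Tr → Lab

-- Lengths of paths: finite (number of transitions) or infinite.
data Len : Set where
  fin : ℕ → Len
  ω   : Len

_<ᴸ_ : ℕ → Len → Set
i <ᴸ fin n = i < n
i <ᴸ ω     = ⊤

_≤ᴸ_ : ℕ → Len → Set
i ≤ᴸ fin n = i ≤ n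
i ≤ᴸ ω     = ⊤

s≤ᴸ⇒<ᴸ : ∀ i (l : Len) → suc i ≤ᴸ l → i <ᴸ l
s≤ᴸ⇒<ᴸ i (fin n) p = p
s≤ᴸ⇒<ᴸ i ω p = p

module _ {L : Labels} (M : LTS L) where
  open Labels L
  open LTS M

  Tr• : Pred Tr 0ℓ
  Tr• t = Act (ℓ t) × ¬ Rec (ℓ t)

  Tr•¬ : Pred Lab 0ℓ → Pred Tr 0ℓ
  Tr•¬ B t = Tr• t × ¬ B (ℓ t)

  -- A path s₀ t₁ s₁ t₂ ⋯ (finite or infinite) of non-indicator transitions.
  -- Transition t_{i+1} is  tr i ;  state s_i is  state π i.
  record Path : Set where
    field
      start  : S
      len    : Len
      tr     : (i : ℕ) → i <ᴸ len → Tr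
      nonind : ∀ i (p : i <ᴸ len) → Act (ℓ (tr i p))
      src₀   : (p : 0 <ᴸ len) → source (tr 0 p) ≡ start
      chain  : ∀ i (p : suc i <ᴸ len) (q : i <ᴸ len) →
               source (tr (suc i) p) ≡ target (tr i q)
  open Path public

  state : (π : Path) (i : ℕ) → i ≤ᴸ len π → S
  state π zero    _ = start π
  state π (suc i) p = target (tr π i (s≤ᴸ⇒<ᴸ i (len π) p))

  EndsIn : Path → S → Set
  EndsIn π s = Σ ℕ λ n → (len π ≡ fin n) × (∀ (p : n ≤ᴸ len π) → state π n p ≡ s)

  Finite : Path → Set
  Finite π = Σ ℕ λ n → len π ≡ fin n

  Prefix : Path → Path → Set
  Prefix π π' = Σ ℕ λ n → (len π ≡ fin n) × (start π ≡ start π') × (n ≤ᴸ len π') ×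
    (∀ i (p : i <ᴸ len π) (q : i <ᴸ len π') → tr π i p ≡ tr π' i q)

record LTSC (L : Labels) : Set₁ where
  field
    lts : LTS L
  open LTS lts
  field
    _⌣•_   : Tr → Tr → Set
    ⌣•-dom : ∀ {t u} → t ⌣• u → Tr• lts t
    irrefl : ∀ t → Tr• lts t → ¬ (t ⌣• t)
    prog   : ∀ t → Tr• lts t → (π : Path lts) → start π ≡ source t →
             ∀ s → EndsIn lts π s →
             (∀ i (p : i <ᴸ len π) → t ⌣• tr π i p) →
             Σ Tr λ u → Tr• lts u × source u ≡ s × ℓ u ≡ ℓ t × ¬ (t ⌣• u)

module _ {L : Labels} (C : LTSC L) where
  open Labels L
  open LTSC C
  open LTS lts

  Just : Pred Lab 0ℓ → Path lts → Set
  Just B π = ∀ k (pk : k ≤ᴸ len π) → ∀ t → Tr•¬ lts B t → source t ≡ state lts π k pk →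
    Σ ℕ λ j → Σ (j <ᴸ len π) λ pj → (k ≤ j) × ¬ (t ⌣• tr π j pj)

  Equiv : Tr → Tr → Set
  Equiv t t' = ∀ u → Tr• lts u → (t ⌣• u) ⇔ (t' ⌣• u)

  -- The equivalence classes (of elements of Tr•¬B) enabled in s are countable:
  -- there is a surjection ℕ → {none} ∪ {enabled classes}, each class given by
  -- a representative in Tr•¬B with source s.
  CountablyManyEnabledClasses : Pred Lab 0ℓ → S → Set
  CountablyManyEnabledClasses B s = Σ (ℕ → Maybe Tr) λ f →
    (∀ n t' → f n ≡ just t' → Tr•¬ lts B t' × source t' ≡ s) ×
    (∀ t → Tr•¬ lts B t → source t ≡ s →
       Σ ℕ λ n → Σ Tr λ t' → f n ≡ just t' × Equiv t t')

module Submission where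

-- Feasibility of B-justness (classically), by a round-robin scheduler.
--
-- An obligation is a pair (k , m): "the m-th enabled class at position k must
-- eventually be interfered with".  Pairs are enumerated by a surjection
-- unpair : ℕ → ℕ × ℕ.  Starting from the given finite path π we build a chain of
-- finite runs runs 0 ⊑ runs 1 ⊑ ⋯.  In a run A, obligation (k , m) is pending if
-- some t ∈ Tr•¬B from the k-th state, equivalent to the m-th enabled class, is
-- concurrent with every transition of A after position k.  A step serves the
-- least pending obligation: the progress axiom (2) of an LTSC, applied to t and
-- the part of A after position k, yields a transition u ∈ Tr• with ¬ t ⌣• u,
-- which is appended.  Since ⌣• only depends on the equivalence class of t, a
-- served obligation is never pending again, so by induction every obligation is
-- eventually settled for good.  If at some stage nothing is pending, that finite
-- run is B-just; otherwise the runs grow forever and their limit is B-just,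
-- because a violation of justness would be an obligation pending forever.

open import Defs
open import Level using (0ℓ)
open import Axiom.ExcludedMiddle using (ExcludedMiddle)
open import Data.Empty using (⊥-elim)
open import Data.Maybe using (Maybe; just)
open import Data.Maybe.Properties using (just-injective)
open import Data.Nat using (ℕ; zero; suc; _≤_; _<_; _+_; _∸_; _⊔_; z≤n; s≤s; _<?_; _≤′_; ≤′-step; ≤′-reflexive)
open import Data.Nat.Induction using (<-rec)
open import Data.Nat.Properties
open import Data.Product using (Σ; _×_; _,_; proj₁; proj₂)
open import Data.Sum using (_⊎_; inj₁; inj₂)
open import Data.Unit using (tt)
open import Function.Bundles using (Equivalence)
open import Relation.Binary.Definitions using (tri<; tri≈; tri>)
open import Relation.Binary.PropositionalEquality
open import Relation.Nullary using (¬_; Dec; yes; no)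
open import Relation.Unary using (Pred; _⊆_)

-- Enumerating ℕ × ℕ diagonal by diagonal: (d , 0), (d ∸ 1 , 1), …, (0 , d), (d + 1 , 0), …

nextPair : ℕ × ℕ → ℕ × ℕ
nextPair (zero  , m) = (suc m , zero)
nextPair (suc k , m) = (k , suc m)

unpair : ℕ → ℕ × ℕ
unpair zero    = (zero , zero)
unpair (suc c) = nextPair (unpair c)

unpair-walk : ∀ m {c k j} → unpair c ≡ (k + m , j) → unpair (m + c) ≡ (k , j + m)
unpair-walk zero {k = k} {j} e = trans e (cong₂ _,_ (+-identityʳ k) (sym (+-identityʳ j)))
unpair-walk (suc m) {c} {k} {j} e = begin
  nextPair (unpair (m + c)) ≡⟨ cong nextPair (unpair-walk m (trans e (cong (_, j) (+-suc k m)))) ⟩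
  (k , suc (j + m))         ≡⟨ cong (k ,_) (sym (+-suc j m)) ⟩
  (k , j + suc m)           ∎
  where open ≡-Reasoning

unpair-diagonal : ∀ d → Σ ℕ λ c → unpair c ≡ (d , zero)
unpair-diagonal zero = zero , refl
unpair-diagonal (suc d) with unpair-diagonal d
... | c , e = suc (d + c) , cong nextPair (unpair-walk d e)

unpair-onto : ∀ k m → Σ ℕ λ c → unpair c ≡ (k , m)
unpair-onto k m with unpair-diagonal (k + m)
... | c , e = m + c , unpair-walk m e

-- The least-number principle, which needs excluded middle for undecidable predicates.

Minimal : (ℕ → Set) → ℕ → Set
Minimal P m = P m × (∀ j → j < m → ¬ P j)

least : ExcludedMiddle 0ℓ → (P : ℕ → Set) → ∀ c → P c → Σ ℕ (Minimal P)
least em P = <-rec (λ c → P c → Σ ℕ (Minimal P)) descend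
  where
  descend : ∀ c → (∀ {j} → j < c → P j → Σ ℕ (Minimal P)) → P c → Σ ℕ (Minimal P)
  descend c below pc with em {Σ ℕ λ j → j < c × P j}
  ... | yes (j , j<c , pj) = below j<c pj
  ... | no none = c , pc , λ j j<c pj → none (j , j<c , pj)

minimal-unique : ∀ {P m c} → Minimal P m → Minimal P c → m ≡ c
minimal-unique {m = m} {c} (pm , min-m) (pc , min-c) with <-cmp m c
... | tri< m<c _ _ = ⊥-elim (min-c m m<c pm)
... | tri≈ _ m≡c _ = m≡c
... | tri> _ _ c<m = ⊥-elim (min-m c c<m pc)

allOrCounterexample : ExcludedMiddle 0ℓ → {I : Set} (Q R : I → Set) →
  (∀ i → Q i → R i) ⊎ Σ I λ i → Q i × ¬ R i
allOrCounterexample em Q R with em {Σ _ λ i → Q i × ¬ R i}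
... | yes counterexample = inj₂ counterexample
... | no none = inj₁ λ i qi → decided i qi (em {R i})
  where
  decided : ∀ i → Q i → Dec (R i) → R i
  decided i qi (yes ri) = ri
  decided i qi (no ¬ri) = ⊥-elim (none (i , qi , ¬ri))

<ᴸ-irrelevant : ∀ {i} l (p q : i <ᴸ l) → p ≡ q
<ᴸ-irrelevant (fin n) p q = <-irrelevant p q
<ᴸ-irrelevant ω tt tt = refl

below-or-at : ∀ {i n} → i < suc n → i < n ⊎ i ≡ n
below-or-at i<1+n = m≤n⇒m<n∨m≡n (≤-pred i<1+n)

shifted-index : ∀ {i k n} → k ≤ n → i < n ∸ k → k + i < n
shifted-index {i} {k} k≤n i<n∸k = subst (k + i <_) (m+[n∸m]≡n k≤n) (+-monoʳ-< k i<n∸k)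

snoc : {X : Set} → (ℕ → X) → ℕ → X → ℕ → X
snoc T n u i with i <? n
... | yes _ = T i
... | no _ = u

snoc-below : ∀ {X : Set} {T : ℕ → X} {n u i} → i < n → snoc T n u i ≡ T i
snoc-below {n = n} {i = i} i<n with i <? n
... | yes _ = refl
... | no i≮n = ⊥-elim (i≮n i<n)

snoc-at : ∀ {X : Set} {T : ℕ → X} {n u} → snoc T n u n ≡ u
snoc-at {n = n} with n <? n
... | yes n<n = ⊥-elim (n≮n n n<n)
... | no _ = refl

-- The construction, for a fixed LTSC, set B, countable enumerations of enabled
-- classes, finite path π of length n₀, and some transition `pad` used to fill
-- the unused tail of finite sequences.
module Scheduler (em : ExcludedMiddle 0ℓ) {Lb : Labels} (C : LTSC Lb)
  (B : Pred (Labels.Lab Lb) 0ℓ)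
  (enum : ∀ s → CountablyManyEnabledClasses C B s)
  (π : Path (LTSC.lts C)) (n₀ : ℕ) (len-π : len π ≡ fin n₀) (pad : LTS.Tr (LTSC.lts C)) where
  open Labels Lb
  open LTSC C
  open LTS lts

  classes : S → ℕ → Maybe Tr
  classes s = proj₁ (enum s)

  ClassOf : S → Tr → Set
  ClassOf s t = Σ ℕ λ m → Σ Tr λ t' → classes s m ≡ just t' × Equiv C t t'

  classOf : ∀ {s t} → Tr•¬ lts B t → source t ≡ s → ClassOf s t
  classOf {s} {t} t∈ t-src = proj₂ (proj₂ (enum s)) t t∈ t-src

  stateOf : (ℕ → Tr) → ℕ → S
  stateOf T zero    = start π
  stateOf T (suc i) = target (T i)

  stateOf-agree : ∀ {T T' n} → (∀ i → i < n → T' i ≡ T i) → ∀ k → k ≤ n → stateOf T' k ≡ stateOf T k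
  stateOf-agree agree zero    _   = refl
  stateOf-agree agree (suc i) i<n = cong target (agree i i<n)

  -- A run: a finite path extending π, given by a sequence whose entries beyond `size` are irrelevant.
  record Run : Set where
    field
      size    : ℕ
      trAt    : ℕ → Tr
      isAct   : ∀ i → i < size → Act (ℓ (trAt i))
      linked  : ∀ i → i < size → source (trAt i) ≡ stateOf trAt i
      covers  : n₀ ≤ size
      extends : ∀ i (p : i <ᴸ len π) → trAt i ≡ tr π i p
  open Run

  _⊑_ : Run → Run → Set
  A ⊑ D = size A ≤ size D × (∀ i → i < size A → trAt D i ≡ trAt A i)

  ⊑-refl : ∀ A → A ⊑ A
  ⊑-refl A = ≤-refl , λ _ _ → refl

  ⊑-trans : ∀ {A D E} → A ⊑ D → D ⊑ E → A ⊑ E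
  ⊑-trans (A≤D , D-agree) (D≤E , E-agree) =
    ≤-trans A≤D D≤E , λ i i<A → trans (E-agree i (<-≤-trans i<A A≤D)) (D-agree i i<A)

  ⊑-state : ∀ {A D} → A ⊑ D → ∀ k → k ≤ size A → stateOf (trAt D) k ≡ stateOf (trAt A) k
  ⊑-state A⊑D = stateOf-agree (proj₂ A⊑D)

  pathOf : Run → Path lts
  pathOf A = record
    { start = start π ; len = fin (size A) ; tr = λ i _ → trAt A i
    ; nonind = isAct A ; src₀ = linked A 0 ; chain = λ i i+1< _ → linked A (suc i) i+1< }

  pathOf-state : ∀ A k p → state lts (pathOf A) k p ≡ stateOf (trAt A) k
  pathOf-state A zero    _ = refl
  pathOf-state A (suc k) _ = refl

  pathOf-prefix : ∀ A → Prefix lts π (pathOf A)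
  pathOf-prefix A = n₀ , len-π , refl , covers A , λ i p _ → sym (extends A i p)

  suffix : (A : Run) (k : ℕ) → k ≤ size A → Path lts
  suffix A k k≤ = record
    { start = stateOf (trAt A) k ; len = fin (size A ∸ k) ; tr = λ i _ → trAt A (k + i)
    ; nonind = λ i i< → isAct A (k + i) (shifted-index k≤ i<)
    ; src₀ = λ 0< → trans (linked A (k + 0) (shifted-index k≤ 0<)) (cong (stateOf (trAt A)) (+-identityʳ k))
    ; chain = λ i i+1< _ → trans (linked A (k + suc i) (shifted-index k≤ i+1<))
                                 (cong (stateOf (trAt A)) (+-suc k i)) }

  suffix-state : ∀ A k k≤ i p → state lts (suffix A k k≤) i p ≡ stateOf (trAt A) (k + i)
  suffix-state A k k≤ zero    _ = cong (stateOf (trAt A)) (sym (+-identityʳ k))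
  suffix-state A k k≤ (suc i) _ = cong (stateOf (trAt A)) (sym (+-suc k i))

  suffix-ends : ∀ A k k≤ → EndsIn lts (suffix A k k≤) (stateOf (trAt A) (size A))
  suffix-ends A k k≤ = size A ∸ k , refl , λ p →
    trans (suffix-state A k k≤ (size A ∸ k) p) (cong (stateOf (trAt A)) (m+[n∸m]≡n k≤))

  record PendingAt (A : Run) (k m : ℕ) : Set where
    field
      inRange : k ≤ size A
      rep     : Tr
      repEq   : classes (stateOf (trAt A) k) m ≡ just rep
      wit     : Tr
      witB    : Tr•¬ lts B wit
      witSrc  : source wit ≡ stateOf (trAt A) k
      witEq   : Equiv C wit rep
      witConc : ∀ i → k ≤ i → i < size A → wit ⌣• trAt A i

  position : ℕ → ℕ
  position c = proj₁ (unpair c)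

  Pending : Run → ℕ → Set
  Pending A c = PendingAt A (position c) (proj₂ (unpair c))

  code : ℕ → ℕ → ℕ
  code k m = proj₁ (unpair-onto k m)

  pending-code : ∀ {A k m} → PendingAt A k m → Pending A (code k m)
  pending-code {A} {k} {m} =
    subst (λ km → PendingAt A (proj₁ km) (proj₂ km)) (sym (proj₂ (unpair-onto k m)))

  pending-of-enabled : ∀ A k → k ≤ size A → ∀ {s} → stateOf (trAt A) k ≡ s →
    ∀ t → Tr•¬ lts B t → source t ≡ s → (∀ i → k ≤ i → i < size A → t ⌣• trAt A i) →
    (cl : ClassOf s t) → PendingAt A k (proj₁ cl)
  pending-of-enabled A k k≤ state≡s t t∈ t-src conc (m , t' , enumerated , t≈t') = record
    { inRange = k≤ ; rep = t' ; repEq = subst (λ s → classes s m ≡ just t') (sym state≡s) enumerated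
    ; wit = t ; witB = t∈ ; witSrc = trans t-src (sym state≡s) ; witEq = t≈t' ; witConc = conc }

  pending-restrict : ∀ {A D k m} → A ⊑ D → k ≤ size A → PendingAt D k m → PendingAt A k m
  pending-restrict {A} {D} {k} {m} A⊑D k≤ p = record
    { inRange = k≤ ; rep = rep
    ; repEq = trans (cong (λ s → classes s m) (sym same-state)) repEq
    ; wit = wit ; witB = witB ; witSrc = trans witSrc same-state ; witEq = witEq
    ; witConc = λ i k≤i i<A →
        subst (wit ⌣•_) (proj₂ A⊑D i i<A) (witConc i k≤i (<-≤-trans i<A (proj₁ A⊑D))) }
    where
    open PendingAt p
    same-state : stateOf (trAt D) k ≡ stateOf (trAt A) k
    same-state = ⊑-state {A} {D} A⊑D k k≤

  module Serve (A : Run) {k m : ℕ} (p : PendingAt A k m) where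
    open PendingAt p

    progress : Σ Tr λ u → Tr• lts u × source u ≡ stateOf (trAt A) (size A) × ℓ u ≡ ℓ wit × ¬ (wit ⌣• u)
    progress = prog wit (proj₁ witB) (suffix A k inRange) (sym witSrc) _ (suffix-ends A k inRange)
      (λ i i< → witConc (k + i) (m≤m+n k i) (shifted-index inRange i<))

    u : Tr
    u = proj₁ progress

    u∈Tr• : Tr• lts u
    u∈Tr• = proj₁ (proj₂ progress)

    extended : ℕ → Tr
    extended = snoc (trAt A) (size A) u

    extended-below : ∀ {i} → i < size A → extended i ≡ trAt A i
    extended-below = snoc-below {T = trAt A} {u = u}

    extended-at : extended (size A) ≡ u
    extended-at = snoc-at {T = trAt A} {n = size A}

    extended-state : ∀ i → i ≤ size A → stateOf extended i ≡ stateOf (trAt A) i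
    extended-state = stateOf-agree (λ i → extended-below)

    extended-act : ∀ i → i < suc (size A) → Act (ℓ (extended i))
    extended-act i i< with below-or-at i<
    ... | inj₁ i<A  = subst (λ v → Act (ℓ v)) (sym (extended-below i<A)) (isAct A i i<A)
    ... | inj₂ refl = subst (λ v → Act (ℓ v)) (sym extended-at) (proj₁ u∈Tr•)

    extended-linked : ∀ i → i < suc (size A) → source (extended i) ≡ stateOf extended i
    extended-linked i i< with below-or-at i<
    ... | inj₁ i<A  = trans (cong source (extended-below i<A))
                        (trans (linked A i i<A) (sym (extended-state i (<⇒≤ i<A))))
    ... | inj₂ refl = trans (cong source extended-at)
                        (trans (proj₁ (proj₂ (proj₂ progress))) (sym (extended-state (size A) ≤-refl)))

    run : Run
    run = record
      { size = suc (size A) ; trAt = extended ; isAct = extended-act ; linked = extended-linked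
      ; covers = ≤-trans (covers A) (n≤1+n _)
      ; extends = λ i p → trans (extended-below (<-≤-trans (subst (i <ᴸ_) len-π p) (covers A))) (extends A i p) }

    run-extends : A ⊑ run
    run-extends = n≤1+n _ , λ i i<A → extended-below i<A

    served : Tr• lts (extended (size A)) × ¬ (wit ⌣• extended (size A))
    served = subst (Tr• lts) (sym extended-at) u∈Tr• ,
             subst (λ v → ¬ (wit ⌣• v)) (sym extended-at) (proj₂ (proj₂ (proj₂ (proj₂ progress))))

  stepWith : (A : Run) → Dec (Σ ℕ (Pending A)) → Run
  stepWith A (no _)         = A
  stepWith A (yes (c , pc)) = Serve.run A (proj₁ (proj₂ (least em (Pending A) c pc)))

  step : Run → Run
  step A = stepWith A em

  step-extends : ∀ A d → A ⊑ stepWith A d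
  step-extends A (no _)         = ⊑-refl A
  step-extends A (yes (c , pc)) = Serve.run-extends A (proj₁ (proj₂ (least em (Pending A) c pc)))

  step-grows : ∀ A d → Σ ℕ (Pending A) → size (stepWith A d) ≡ suc (size A)
  step-grows A (no idle)      busy = ⊥-elim (idle busy)
  step-grows A (yes (c , pc)) _    = refl

  step-serves : ∀ A c → Minimal (Pending A) c → ∀ d →
    Σ (Pending A c) λ pw → Tr• lts (trAt (stepWith A d) (size A)) ×
                           ¬ (PendingAt.wit pw ⌣• trAt (stepWith A d) (size A))
  step-serves A c min-c (no idle) = ⊥-elim (idle (c , proj₁ min-c))
  step-serves A c min-c (yes (c₀ , p₀)) with least em (Pending A) c₀ p₀
  ... | m , min-m with minimal-unique min-m min-c
  ... | refl = proj₁ min-m , Serve.served A (proj₁ min-m)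

  within-π : ∀ {i} → i < n₀ → i <ᴸ len π
  within-π {i} = subst (i <ᴸ_) (sym len-π)

  initial-tr : ℕ → Tr
  initial-tr i with i <? n₀
  ... | yes i<n₀ = tr π i (within-π i<n₀)
  ... | no _     = pad

  initial-tr-π : ∀ {i} → i < n₀ → (p : i <ᴸ len π) → initial-tr i ≡ tr π i p
  initial-tr-π {i} i<n₀ p with i <? n₀
  ... | yes _    = cong (tr π i) (<ᴸ-irrelevant (len π) _ p)
  ... | no i≮n₀ = ⊥-elim (i≮n₀ i<n₀)

  initial-linked : ∀ i → i < n₀ → source (initial-tr i) ≡ stateOf initial-tr i
  initial-linked zero    0<n₀ = trans (cong source (initial-tr-π 0<n₀ (within-π 0<n₀))) (src₀ π _)
  initial-linked (suc i) i+1<n₀ = trans (cong source (initial-tr-π i+1<n₀ (within-π i+1<n₀)))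
    (trans (chain π i _ (within-π i<n₀)) (cong target (sym (initial-tr-π i<n₀ _))))
    where
    i<n₀ : i < n₀
    i<n₀ = <-trans (n<1+n i) i+1<n₀

  initial : Run
  initial = record
    { size = n₀ ; trAt = initial-tr
    ; isAct = λ i i<n₀ → subst (λ v → Act (ℓ v)) (sym (initial-tr-π i<n₀ (within-π i<n₀))) (nonind π i _)
    ; linked = initial-linked ; covers = ≤-refl
    ; extends = λ i p → initial-tr-π (subst (i <ᴸ_) len-π p) p }

  runs : ℕ → Run
  runs zero    = initial
  runs (suc N) = step (runs N)

  runs-mono′ : ∀ {a b} → a ≤′ b → runs a ⊑ runs b
  runs-mono′ {a} (≤′-reflexive refl) = ⊑-refl (runs a)
  runs-mono′ {a} {suc b} (≤′-step a≤b) =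
    ⊑-trans {runs a} {runs b} {runs (suc b)} (runs-mono′ a≤b) (step-extends (runs b) em)

  runs-mono : ∀ {a b} → a ≤ b → runs a ⊑ runs b
  runs-mono a≤b = runs-mono′ (≤⇒≤′ a≤b)

  Result : Set
  Result = Σ (Path lts) λ π' → Just C B π' × Prefix lts π π'

  -- A run with no pending obligation is B-just: a transition of Tr•¬B enabled at
  -- position k and never interfered with would make its obligation pending.
  idle-just : (A : Run) → ¬ Σ ℕ (Pending A) → Just C B (pathOf A)
  idle-just A idle k k≤ t t∈ t-src
    with allOrCounterexample em (λ i → k ≤ i × i < size A) (λ i → t ⌣• trAt A i)
  ... | inj₂ (j , (k≤j , j<A) , ¬conc) = j , j<A , k≤j , ¬conc
  ... | inj₁ conc = ⊥-elim (idle (code k (proj₁ cl) , pending-code pending))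
    where
    cl = classOf t∈ t-src
    pending : PendingAt A k (proj₁ cl)
    pending = pending-of-enabled A k k≤ (sym (pathOf-state A k k≤)) t t∈ t-src
      (λ i k≤i i<A → conc i (k≤i , i<A)) cl

  -- Once served as the least pending obligation at stage N, obligation c is never
  -- pending later: any later witness is equivalent to the served one, so the
  -- appended transition interferes with it too.
  served-never-pending : ∀ N c → Minimal (Pending (runs N)) c → ∀ N' → suc N ≤ N' → ¬ Pending (runs N') c
  served-never-pending N c min-c N' N<N' later = ¬served-conc served-conc
    where
    A = runs N
    serving = step-serves A c min-c em
    pw = proj₁ serving
    open PendingAt
    u = trAt (runs (suc N)) (size A)
    ¬served-conc : ¬ (wit pw ⌣• u)
    ¬served-conc = proj₂ (proj₂ serving)
    u∈Tr• : Tr• lts u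
    u∈Tr• = proj₁ (proj₂ serving)
    after : runs (suc N) ⊑ runs N'
    after = runs-mono N<N'
    u-position : size A < size (runs (suc N))
    u-position = ≤-reflexive (sym (step-grows A em (c , proj₁ min-c)))
    later-conc : wit later ⌣• u
    later-conc = subst (wit later ⌣•_) (proj₂ after (size A) u-position)
      (witConc later (size A) (inRange pw) (<-≤-trans u-position (proj₁ after)))
    same-state : stateOf (trAt (runs N')) (position c) ≡ stateOf (trAt A) (position c)
    same-state = ⊑-state {A} {runs N'} (runs-mono (<⇒≤ N<N')) _ (inRange pw)
    same-rep : rep later ≡ rep pw
    same-rep = just-injective (trans (sym (repEq later))
      (trans (cong (λ s → classes s (proj₂ (unpair c))) same-state) (repEq pw)))
    served-conc : wit pw ⌣• u
    served-conc = Equivalence.from (witEq pw u u∈Tr•)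
      (subst (_⌣• u) same-rep (Equivalence.to (witEq later u u∈Tr•) later-conc))

  module Limit (busy : ∀ N → Σ ℕ (Pending (runs N))) where
    runs-size : ∀ N → N ≤ size (runs N)
    runs-size zero    = z≤n
    runs-size (suc N) = ≤-trans (s≤s (runs-size N)) (≤-reflexive (sym (step-grows (runs N) em (busy N))))

    runs-agree : ∀ a b i → i < size (runs a) → i < size (runs b) → trAt (runs b) i ≡ trAt (runs a) i
    runs-agree a b i i<a i<b with ≤-total a b
    ... | inj₁ a≤b = proj₂ (runs-mono a≤b) i i<a
    ... | inj₂ b≤a = sym (proj₂ (runs-mono b≤a) i i<b)

    -- The i-th transition of the limit is fixed from stage i + 1 on.
    limit-tr : ℕ → Tr
    limit-tr i = trAt (runs (suc i)) i

    limit-tr-agree : ∀ N i → i < size (runs N) → limit-tr i ≡ trAt (runs N) i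
    limit-tr-agree N i i<N = runs-agree N (suc i) i i<N (runs-size (suc i))

    limit : Path lts
    limit = record
      { start = start π ; len = ω ; tr = λ i _ → limit-tr i
      ; nonind = λ i _ → isAct (runs (suc i)) i (runs-size (suc i))
      ; src₀ = λ _ → linked (runs 1) 0 (runs-size 1)
      ; chain = λ i _ _ → trans (linked (runs (suc (suc i))) (suc i) (runs-size _))
          (cong target (sym (limit-tr-agree (suc (suc i)) i (<⇒≤ (runs-size _))))) }

    limit-state : ∀ N k p → k ≤ size (runs N) → state lts limit k p ≡ stateOf (trAt (runs N)) k
    limit-state N zero    _ _   = refl
    limit-state N (suc i) _ i<N = cong target (limit-tr-agree N i i<N)

    limit-prefix : Prefix lts π limit
    limit-prefix = n₀ , len-π , refl , tt , λ i p _ → sym (extends (runs (suc i)) i p)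

    SettledBelow : ℕ → ℕ → Set
    SettledBelow c N = ∀ c' → c' < c → ∀ N' → N ≤ N' → ¬ Pending (runs N') c'

    -- Fairness: each obligation is eventually settled.  If c were pending after stage
    -- M = N ⊔ position c, it was pending, hence the least pending obligation, at M.
    fair : ∀ c → Σ ℕ (SettledBelow c)
    fair zero = zero , λ _ ()
    fair (suc c) with fair c
    ... | N , settled = suc M , settled-suc
      where
      M = N ⊔ position c
      never-again : ∀ N' → suc M ≤ N' → ¬ Pending (runs N') c
      never-again N' M<N' pending = served-never-pending M c (pending-at-M , minimal) N' M<N' pending
        where
        pending-at-M : Pending (runs M) c
        pending-at-M = pending-restrict (runs-mono (≤-trans (n≤1+n M) M<N'))
          (≤-trans (m≤n⊔m N _) (runs-size M)) pending
        minimal : ∀ j → j < c → ¬ Pending (runs M) j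
        minimal j j<c = settled j j<c M (m≤m⊔n N _)
      settled-suc : SettledBelow (suc c) (suc M)
      settled-suc c' c'<1+c N' M<N' with below-or-at c'<1+c
      ... | inj₁ c'<c = settled c' c'<c N' (≤-trans (m≤m⊔n N _) (≤-trans (n≤1+n M) M<N'))
      ... | inj₂ refl = never-again N' M<N'

    -- A transition enabled at position k and never interfered with afterwards would
    -- make its obligation pending at every late enough stage, contradicting fairness.
    limit-just : Just C B limit
    limit-just k p t t∈ t-src with allOrCounterexample em (k ≤_) (λ i → t ⌣• limit-tr i)
    ... | inj₂ (j , k≤j , ¬conc) = j , tt , k≤j , ¬conc
    ... | inj₁ conc = ⊥-elim (proj₂ (fair (suc c)) c (n<1+n c) M (m≤m⊔n N k) (pending-code pending))
      where
      cl = classOf t∈ t-src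
      c = code k (proj₁ cl)
      N = proj₁ (fair (suc c))
      M = N ⊔ k
      k≤M : k ≤ size (runs M)
      k≤M = ≤-trans (m≤n⊔m N k) (runs-size M)
      pending : PendingAt (runs M) k (proj₁ cl)
      pending = pending-of-enabled (runs M) k k≤M (sym (limit-state M k p k≤M)) t t∈ t-src
        (λ i k≤i i<M → subst (t ⌣•_) (limit-tr-agree M i i<M) (conc i k≤i)) cl

  feasible : Result
  feasible with em {Σ ℕ λ N → ¬ Σ ℕ (Pending (runs N))}
  ... | yes (N , idle) = pathOf (runs N) , idle-just (runs N) idle , pathOf-prefix (runs N)
  ... | no ¬idle = Limit.limit busy , Limit.limit-just busy , Limit.limit-prefix busy
    where
    busy : ∀ N → Σ ℕ (Pending (runs N))
    busy N with em {Σ ℕ (Pending (runs N))}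
    ... | yes pending = pending
    ... | no none     = ⊥-elim (¬idle (N , none))

no-transitions-just : ∀ {L} (C : LTSC L) B → ¬ LTS.Tr (LTSC.lts C) → ∀ π → Just C B π
no-transitions-just C B ¬tr π k p t = ⊥-elim (¬tr t)

prefix-refl : ∀ {L} (M : LTS L) (π : Path M) → Finite M π → Prefix M π π
prefix-refl M π (n , len≡) =
  n , len≡ , refl , subst (n ≤ᴸ_) (sym len≡) ≤-refl , λ i p q → cong (tr π i) (<ᴸ-irrelevant (len π) p q)

corollary1 : ExcludedMiddle 0ℓ →
    {L : Labels} (C : LTSC L) (B : Pred (Labels.Lab L) 0ℓ) →
    Labels.Rec L ⊆ B → B ⊆ Labels.Act L →
    (∀ s → CountablyManyEnabledClasses C B s) →
    ∀ (π : Path (LTSC.lts C)) → Finite (LTSC.lts C) π →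
    Σ (Path (LTSC.lts C)) λ π' → Just C B π' × Prefix (LTSC.lts C) π π'
corollary1 em C B _ _ enum π (n₀ , len-π) with em {LTS.Tr (LTSC.lts C)}
... | yes pad = Scheduler.feasible em C B enum π n₀ len-π pad
... | no ¬tr  = π , no-transitions-just C B ¬tr π , prefix-refl (LTSC.lts C) π (n₀ , len-π)
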